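{- Let $G$ be a connected $(P_5, K_1+(K_1\cup K_3))$-free graph with no clique cutset, let $C=v_1v_2v_3v_4v_5v_1$ be a $5$-hole of $G$, and let $S$ be a component of $G[N_{\{1,2,3,4,5\}}(C)]$ with $\omega(S)\ge 2$. Then for each $i\in\{1,\dots,5\}$ (indices modulo $5$): (a) $N_{\{i,i+2\}}(C)\cup N_{\{i,i+1,i+2\}}(C)$ is complete to $V(S)$, and $N_{\{i,i+2\}}(C)$ is independent; (b) for each edge $xy$ of $S$, no vertex of $N_{\{i,i+1,i+3\}}(C)\cup N_{\{i,i+1,i+2,i+3\}}(C)$ is anticomplete to $\{x,y\}$; (c) $N_{\{i,i+2\}}(C)$ is anticomplete to $N_{\{i-1,i,i+1\}}(C)\cup N_{\{i-1,i,i+2\}}(C)\cup N_{\{i-1,i,i+1,i+2\}}(C)$; (d) $\chi(G-N_{\{1,2,3,4,5\}}(C)-M(C))\le 5$.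
   Context: All graphs are finite and simple. $K_1+(K_1\cup K_3)$ is $K_4$ plus a new vertex adjacent to exactly one vertex of the $K_4$; $(P_5,K_1+(K_1\cup K_3))$-free means no induced subgraph isomorphic to the five-vertex path or to this graph. A clique cutset is a clique whose removal disconnects the graph. A $5$-hole is an induced $5$-cycle. For a $5$-hole $C$: $N(C)$ is the set of vertices outside $V(C)$ with a neighbor in $V(C)$; $M(C)=V(G)\setminus(V(C)\cup N(C))$; for $T\subseteq\{1,\dots,5\}$, $N_T(C)=\{x\in N(C): xv_j\in E(G)\text{ iff } j\in T\}$. $X$ is complete (anticomplete) to $Y$ if every vertex of $X$ is adjacent (non-adjacent) to every vertex of $Y$. $\omega$ is clique number, $\chi$ chromatic number. -}

module Defs where

open import Data.Nat using (ℕ; zero; suc; _+_; _<ᵇ_; _≡ᵇ_)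
open import Data.Nat.DivMod using (_%_; m%n<n)
open import Data.Fin using (Fin; toℕ; fromℕ<; zero; suc)
open import Data.Fin.Subset using (Subset; _∈_; _∉_)
open import Data.Bool using (Bool; true; false; _∨_; _∧_)
open import Data.Bool.Properties using (∨-comm)
open import Data.Product using (Σ; ∃; _×_; _,_)
open import Data.Sum using (_⊎_)
open import Data.Unit using (⊤)
open import Data.List using (List)
open import Data.List.Membership.Propositional using () renaming (_∈_ to _∈ₗ_)
open import Function.Bundles using (_⇔_)
open import Function.Definitions using (Injective)
open import Relation.Nullary using (¬_)
open import Relation.Binary.PropositionalEquality using (_≡_; _≢_; refl)

record Graph : Set where
  field
    n       : ℕ
    adj     : Fin n → Fin n → Bool
    adj-sym : ∀ u v → adj u v ≡ adj v u
    adj-irr : ∀ v → adj v v ≡ false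

V : Graph → Set
V G = Fin (Graph.n G)

E : (G : Graph) → V G → V G → Set
E G u v = Graph.adj G u v ≡ true

record Induced (H G : Graph) : Set where
  field
    emb      : V H → V G
    emb-inj  : Injective _≡_ _≡_ emb
    emb-adj  : ∀ a b → Graph.adj H a b ≡ Graph.adj G (emb a) (emb b)
open Induced public

Free : Graph → Graph → Set
Free H G = ¬ Induced H G

symClose : (Fin 5 → Fin 5 → Bool) → Fin 5 → Fin 5 → Bool
symClose e i j = e i j ∨ e j i

_⊕_ : Fin 5 → ℕ → Fin 5
i ⊕ k = fromℕ< (m%n<n (toℕ i + k) 5)

p5e : Fin 5 → Fin 5 → Bool
p5e i j = (toℕ i + 1) ≡ᵇ toℕ j

P5 : Graph
P5 = record { n = 5 ; adj = symClose p5e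
            ; adj-sym = λ u v → ∨-comm (p5e u v) (p5e v u)
            ; adj-irr = irr }
  where
  irr : ∀ v → symClose p5e v v ≡ false
  irr zero = refl
  irr (suc zero) = refl
  irr (suc (suc zero)) = refl
  irr (suc (suc (suc zero))) = refl
  irr (suc (suc (suc (suc zero)))) = refl

c5e : Fin 5 → Fin 5 → Bool
c5e i j = toℕ (i ⊕ 1) ≡ᵇ toℕ j

C5 : Graph
C5 = record { n = 5 ; adj = symClose c5e
            ; adj-sym = λ u v → ∨-comm (c5e u v) (c5e v u)
            ; adj-irr = irr }
  where
  irr : ∀ v → symClose c5e v v ≡ false
  irr zero = refl
  irr (suc zero) = refl
  irr (suc (suc zero)) = refl
  irr (suc (suc (suc zero))) = refl
  irr (suc (suc (suc (suc zero)))) = refl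

-- K1 + (K1 ∪ K3): vertices 0,1,2,3 form a K4, vertex 4 adjacent only to 0
-- (0 is the K1 joined to everything, {1,2,3} the K3, 4 the isolated K1).
k13e : Fin 5 → Fin 5 → Bool
k13e i j = (toℕ i <ᵇ toℕ j) ∧ ((toℕ j <ᵇ 4) ∨ (toℕ i ≡ᵇ 0))

K1+K1∪K3 : Graph
K1+K1∪K3 = record { n = 5 ; adj = symClose k13e
                  ; adj-sym = λ u v → ∨-comm (k13e u v) (k13e v u)
                  ; adj-irr = irr }
  where
  irr : ∀ v → symClose k13e v v ≡ false
  irr zero = refl
  irr (suc zero) = refl
  irr (suc (suc zero)) = refl
  irr (suc (suc (suc zero))) = refl
  irr (suc (suc (suc (suc zero)))) = refl

-- walk from u to v all of whose vertices satisfy P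
-- (i.e. u,v in the same component of G[P] when P u)
data Reach (G : Graph) (P : V G → Set) : V G → V G → Set where
  here : ∀ {u} → P u → Reach G P u u
  step : ∀ {u w v} → P u → E G u w → Reach G P w v → Reach G P u v

Connected : Graph → Set
Connected G = ∀ u v → Reach G (λ _ → ⊤) u v

IsClique : (G : Graph) → Subset (Graph.n G) → Set
IsClique G K = ∀ u v → u ∈ K → v ∈ K → u ≢ v → E G u v

IsCliqueCutset : (G : Graph) → Subset (Graph.n G) → Set
IsCliqueCutset G K =
  IsClique G K ×
  Σ (V G) λ u → Σ (V G) λ v → u ∉ K × v ∉ K × ¬ Reach G (λ w → w ∉ K) u v

HasNoCliqueCutset : Graph → Set
HasNoCliqueCutset G = ¬ Σ (Subset (Graph.n G)) (IsCliqueCutset G)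

ClNumAtLeast : (G : Graph) → (V G → Set) → ℕ → Set
ClNumAtLeast G P k =
  Σ (Fin k → V G) λ f → Injective _≡_ _≡_ f × (∀ a → P (f a)) ×
    (∀ a b → a ≢ b → E G (f a) (f b))

ChiAtMost : (G : Graph) → (V G → Set) → ℕ → Set
ChiAtMost G P k =
  Σ (V G → Fin k) λ col → ∀ u v → P u → P v → E G u v → col u ≢ col v

-- 5-holes and their neighbourhoods.
-- A 5-hole C = v₁v₂v₃v₄v₅v₁ is an induced copy of C5; vertex j : Fin 5
-- of C5 plays the role of v_{j+1}.

Hole5 : Graph → Set
Hole5 G = Induced C5 G

module _ (G : Graph) (C : Hole5 G) where

  inC : V G → Set
  inC x = Σ (Fin 5) λ j → x ≡ emb C j

  NT : List (Fin 5) → V G → Set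
  NT T x = ¬ inC x × (∀ j → E G x (emb C j) ⇔ (j ∈ₗ T))

  NC : V G → Set
  NC x = ¬ inC x × Σ (Fin 5) λ j → E G x (emb C j)

  MC : V G → Set
  MC x = ¬ inC x × ¬ NC x

  all5 : List (Fin 5)
  all5 = zero Data.List.∷ (suc zero) Data.List.∷ (suc (suc zero))
         Data.List.∷ (suc (suc (suc zero)))
         Data.List.∷ (suc (suc (suc (suc zero)))) Data.List.∷ Data.List.[]

  Nall : V G → Set
  Nall = NT all5

  CompOf : V G → V G → Set
  CompOf s y = Nall y × Reach G Nall s y

-- Fix an edge x₁x₂ of G[N_{1,2,3,4,5}(C)].  The subgraph induced by C, x₁, x₂
-- and one or two further vertices z₁, z₂ is determined by the attachments of
-- the zᵢ (the sets of hole vertices they see) and by their adjacencies to x₁,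
-- x₂ and to each other, so there are finitely many such configurations.
-- Deciding them all shows that, unless the configuration contains an induced
-- P₅ or K₁+(K₁∪K₃): every attachment other than ∅ and {1,…,5} is {k+2,k+4} or
-- {k+1,k+2,k+4} for some k (colour class k); two vertices of the same colour
-- class are non-adjacent; a vertex of N_{i,i+2} sees both ends of the edge;
-- and a vertex of N_{i,i+1,i+3} sees at least one of them.  Colouring
-- C ∪ N(C) ∖ N_{1,2,3,4,5}(C) by colour classes gives (d), and (a)–(c) follow
-- because N_{i,i+2} and N_{i-1,i,i+2} lie in colour class i+3, three or four
-- consecutive indices never form an admissible attachment, and every vertex of
-- S lies on an edge of S.

module Submission where

open import Defs
open import Data.Bool using (Bool; true; false; not; _∧_)
open import Data.Bool.Properties using (¬-not) renaming (_≟_ to _≟ᵇ_)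
open import Data.Empty using (⊥-elim)
open import Data.Fin using (Fin; zero; suc; _≟_)
open import Data.Fin.Properties using (all?; any?)
open import Data.Fin.Subset using (Subset; ⊥; ⊤)
open import Data.Fin.Subset.Properties using (anySubset?)
open import Data.List using (List; []; _∷_; concatMap; map; upTo)
open import Data.List.Membership.DecPropositional (_≟_ {5}) using (_∈?_)
open import Data.List.Membership.Propositional using (_∈_)
open import Data.List.Relation.Unary.All as All using (All)
open import Data.List.Relation.Unary.Any as Any using (Any; here; there)
open import Data.Nat using (ℕ)
open import Data.Product using (∃; _×_; _,_; proj₁; proj₂)
open import Data.Sum using (_⊎_; inj₁; inj₂; [_,_]′)
open import Data.Vec as Vec using (Vec; lookup; tabulate; _∷_; [])
open import Data.Vec.Properties using (≡-dec; lookup∘tabulate; lookup-replicate; tabulate-cong)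
open import Function using (_∘_; id)
open import Function.Bundles using (Equivalence; mk⇔)
open import Relation.Binary.PropositionalEquality using (_≡_; _≢_; refl; sym; trans; cong; cong₂; subst; subst₂; module ≡-Reasoning)
open import Relation.Nullary using (¬_; Dec; yes; no; does)
open import Relation.Nullary.Decidable using (toWitness; map′; ¬?; _⊎-dec_; _×-dec_; _→-dec_; decidable-stable)
open import Relation.Unary using (Pred; Decidable)

∀-Subset? : ∀ {n ℓ} {P : Pred (Subset n) ℓ} → Decidable P → Dec (∀ t → P t)
∀-Subset? P? = map′ (λ ∄¬P t → decidable-stable (P? t) (λ ¬Pt → ∄¬P (t , ¬Pt)))
                    (λ ∀P (t , ¬Pt) → ¬Pt (∀P t))
                    (¬? (anySubset? (¬? ∘ P?)))

_≟ˢ_ : ∀ {n} (s t : Subset n) → Dec (s ≡ t)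
_≟ˢ_ = ≡-dec _≟ᵇ_

true≢false : true ≢ false
true≢false ()

E-sym : ∀ {G u v} → E G u v → E G v u
E-sym {G} {u} {v} e = trans (Graph.adj-sym G v u) e

TwinFree : Graph → Set
TwinFree H = ∀ a b → a ≢ b → ∃ λ c → Graph.adj H a c ≢ Graph.adj H b c

twinFree? : ∀ H → Dec (TwinFree H)
twinFree? H = all? λ a → all? λ b →
  ¬? (a ≟ b) →-dec any? λ c → ¬? (Graph.adj H a c ≟ᵇ Graph.adj H b c)

P5-twinFree : TwinFree P5
P5-twinFree = toWitness {a? = twinFree? P5} _

K1+K1∪K3-twinFree : TwinFree K1+K1∪K3
K1+K1∪K3-twinFree = toWitness {a? = twinFree? K1+K1∪K3} _

twinFree-induced : ∀ {H G} → TwinFree H → (w : V H → V G) →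
  (∀ a b → Graph.adj H a b ≡ Graph.adj G (w a) (w b)) → Induced H G
twinFree-induced {H} {G} twinFree w w-adj =
  record { emb = w ; emb-inj = injective ; emb-adj = w-adj }
  where
  injective : ∀ {a b} → w a ≡ w b → a ≡ b
  injective {a} {b} wa≡wb with a ≟ b
  ... | yes a≡b = a≡b
  ... | no a≢b = ⊥-elim (separated (begin
    Graph.adj H a c          ≡⟨ w-adj a c ⟩
    Graph.adj G (w a) (w c)  ≡⟨ cong (λ v → Graph.adj G v (w c)) wa≡wb ⟩
    Graph.adj G (w b) (w c)  ≡⟨ sym (w-adj b c) ⟩
    Graph.adj H b c          ∎))
    where
    open ≡-Reasoning
    c = proj₁ (twinFree a b a≢b)
    separated = proj₂ (twinFree a b a≢b)

module _ {G : Graph} {P : V G → Set} where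

  reach-source : ∀ {u v} → Reach G P u v → P u
  reach-source (here pu) = pu
  reach-source (step pu _ _) = pu

  reach-start : ∀ {u v} → Reach G P u v → u ≡ v ⊎ ∃ λ w → P w × E G u w
  reach-start (here _) = inj₁ refl
  reach-start (step _ u~w r) = inj₂ (_ , reach-source r , u~w)

  reach-end : ∀ {u v} → Reach G P u v → u ≡ v ⊎ ∃ λ w → P w × E G v w
  reach-end (here _) = inj₁ refl
  reach-end (step pu u~w r) with reach-end r
  ... | inj₁ refl = inj₂ (_ , pu , E-sym {G} u~w)
  ... | inj₂ nbr = inj₂ nbr

  component-neighbour : ∀ {s a b y} → Reach G P s a → Reach G P s b → a ≢ b →
    Reach G P s y → ∃ λ w → P w × E G y w
  component-neighbour s⇝a s⇝b a≢b s⇝y with reach-end s⇝y | reach-start s⇝a | reach-start s⇝b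
  ... | inj₂ nbr | _ | _ = nbr
  ... | inj₁ refl | inj₂ nbr | _ = nbr
  ... | inj₁ refl | inj₁ _ | inj₂ nbr = nbr
  ... | inj₁ refl | inj₁ refl | inj₁ refl = ⊥-elim (a≢b refl)

indicator : List (Fin 5) → Subset 5
indicator T = tabulate (λ j → does (j ∈? T))

pairType forkType : Fin 5 → Subset 5
pairType i = indicator (i ∷ i ⊕ 2 ∷ [])
forkType i = indicator (i ∷ i ⊕ 1 ∷ i ⊕ 3 ∷ [])

colourClass : Fin 5 → List (Subset 5)
colourClass k = pairType (k ⊕ 2) ∷ forkType (k ⊕ 1) ∷ []

Admissible : Subset 5 → Set
Admissible t = ∃ λ k → t ∈ colourClass k

admissible? : Decidable Admissible
admissible? t = any? λ k → Any.any? (t ≟ˢ_) (colourClass k)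

colourOf : ∀ {t} → Dec (Admissible t) → Fin 5
colourOf (yes (k , _)) = k
colourOf (no _) = zero

colourOf-class : ∀ {t} (admissible : Dec (Admissible t)) → Admissible t →
  t ∈ colourClass (colourOf admissible)
colourOf-class (yes (_ , t∈k)) _ = t∈k
colourOf-class (no inadmissible) admissible = ⊥-elim (inadmissible admissible)

Exceptional : Subset 5 → Set
Exceptional t = t ≢ ⊥ × t ≢ ⊤ × ¬ Admissible t

exceptional? : Decidable Exceptional
exceptional? t = ¬? (t ≟ˢ ⊥) ×-dec ¬? (t ≟ˢ ⊤) ×-dec ¬? (admissible? t)

pairType-colourClass : ∀ i → pairType i ∈ colourClass (i ⊕ 3)
pairType-colourClass = toWitness {a? = all? λ i → Any.any? (pairType i ≟ˢ_) (colourClass (i ⊕ 3))} _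

fork-colourClass : ∀ i → indicator ((i ⊕ 4) ∷ i ∷ (i ⊕ 2) ∷ []) ∈ colourClass (i ⊕ 3)
fork-colourClass = toWitness {a? = all? λ i →
  Any.any? (indicator ((i ⊕ 4) ∷ i ∷ (i ⊕ 2) ∷ []) ≟ˢ_) (colourClass (i ⊕ 3))} _

runs-exceptional : ∀ i →
  Exceptional (indicator (i ∷ i ⊕ 1 ∷ i ⊕ 2 ∷ []))
  × Exceptional (indicator (i ∷ i ⊕ 1 ∷ i ⊕ 2 ∷ i ⊕ 3 ∷ []))
  × Exceptional (indicator ((i ⊕ 4) ∷ i ∷ (i ⊕ 1) ∷ []))
  × Exceptional (indicator ((i ⊕ 4) ∷ i ∷ (i ⊕ 1) ∷ (i ⊕ 2) ∷ []))
runs-exceptional = toWitness {a? = all? λ i →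
  exceptional? (indicator (i ∷ i ⊕ 1 ∷ i ⊕ 2 ∷ []))
  ×-dec exceptional? (indicator (i ∷ i ⊕ 1 ∷ i ⊕ 2 ∷ i ⊕ 3 ∷ []))
  ×-dec exceptional? (indicator ((i ⊕ 4) ∷ i ∷ (i ⊕ 1) ∷ []))
  ×-dec exceptional? (indicator ((i ⊕ 4) ∷ i ∷ (i ⊕ 1) ∷ (i ⊕ 2) ∷ []))} _

-- Configurations: the hole v₁ … v₅, an edge x₁x₂ complete to it, and two
-- probes z₁, z₂ (possibly the same vertex of G) with prescribed adjacencies.

data Point : Set where
  hole  : Fin 5 → Point
  hub   : Fin 2 → Point
  probe : Fin 2 → Point

pattern v₁ = hole zero
pattern v₂ = hole (suc zero)
pattern v₃ = hole (suc (suc zero))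
pattern v₄ = hole (suc (suc (suc zero)))
pattern v₅ = hole (suc (suc (suc (suc zero))))
pattern x₁ = hub zero
pattern x₂ = hub (suc zero)
pattern z₁ = probe zero
pattern z₂ = probe (suc zero)

record Config : Set where
  field
    attachments    : Vec (Subset 5) 2
    hubNeighbours  : Vec (Subset 2) 2
    probesAdjacent : Bool
open Config

adjᶜ : Config → Point → Point → Bool
adjᶜ κ (hole i)  (hole j)  = Graph.adj C5 i j
adjᶜ κ (hole _)  (hub _)   = true
adjᶜ κ (hub _)   (hole _)  = true
adjᶜ κ (hub a)   (hub b)   = not (does (a ≟ b))
adjᶜ κ (hole i)  (probe k) = lookup (lookup (attachments κ) k) i
adjᶜ κ (probe k) (hole i)  = lookup (lookup (attachments κ) k) i
adjᶜ κ (hub a)   (probe k) = lookup (lookup (hubNeighbours κ) k) a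
adjᶜ κ (probe k) (hub a)   = lookup (lookup (hubNeighbours κ) k) a
adjᶜ κ (probe k) (probe l) = not (does (k ≟ l)) ∧ probesAdjacent κ

twoProbes : (t u : Subset 5) (g h : Subset 2) → Bool → Config
twoProbes t u g h b = record
  { attachments = t ∷ u ∷ [] ; hubNeighbours = g ∷ h ∷ [] ; probesAdjacent = b }

oneProbe : Subset 5 → Subset 2 → Config
oneProbe t h = twoProbes t t h h false

Induces : (H : Graph) → Config → Vec Point (Graph.n H) → Set
Induces H κ f = ∀ a b → Graph.adj H a b ≡ adjᶜ κ (lookup f a) (lookup f b)

induces? : ∀ H κ → Decidable (Induces H κ)
induces? H κ f = all? λ a → all? λ b → Graph.adj H a b ≟ᵇ adjᶜ κ (lookup f a) (lookup f b)

rotate : ℕ → Point → Point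
rotate r (hole i) = hole (i ⊕ r)
rotate r p        = p

swapHubs : Point → Point
swapHubs x₁ = x₂
swapHubs x₂ = x₁
swapHubs p  = p

swapProbes : Point → Point
swapProbes z₁ = z₂
swapProbes z₂ = z₁
swapProbes p  = p

symmetries : List (Point → Point)
symmetries = concatMap (λ r → map (_∘ rotate r)
  (id ∷ swapHubs ∷ swapProbes ∷ (swapHubs ∘ swapProbes) ∷ [])) (upTo 5)

images : List (Vec Point 5) → List (Vec Point 5)
images fs = concatMap (λ g → map (Vec.map g) fs) symmetries

-- Up to the symmetries above, six induced subgraphs suffice: a P₅ and five
-- copies of K₁+(K₁∪K₃), each listed with its dominating vertex first and the
-- pendant vertex last.

pathObstructions : List (Vec Point 5)
pathObstructions = (v₁ ∷ v₅ ∷ v₄ ∷ v₃ ∷ z₁ ∷ []) ∷ []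

pendantK₄Obstructions : List (Vec Point 5)
pendantK₄Obstructions =
    (x₁ ∷ v₁ ∷ x₂ ∷ v₂ ∷ z₁ ∷ [])
  ∷ (v₁ ∷ v₅ ∷ x₁ ∷ x₂ ∷ z₁ ∷ [])
  ∷ (x₁ ∷ z₁ ∷ v₁ ∷ z₂ ∷ v₄ ∷ [])
  ∷ (x₁ ∷ v₁ ∷ z₁ ∷ v₂ ∷ v₄ ∷ [])
  ∷ (v₁ ∷ z₁ ∷ v₅ ∷ z₂ ∷ v₂ ∷ [])
  ∷ []

Obstructed : Config → Set
Obstructed κ = Any (Induces P5 κ) (images pathObstructions)
             ⊎ Any (Induces K1+K1∪K3 κ) (images pendantK₄Obstructions)

obstructed? : Decidable Obstructed
obstructed? κ = Any.any? (induces? P5 κ) (images pathObstructions)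
          ⊎-dec Any.any? (induces? K1+K1∪K3 κ) (images pendantK₄Obstructions)

exceptional-obstructed : ∀ t → Exceptional t → ∀ h → Obstructed (oneProbe t h)
exceptional-obstructed = toWitness {a? = ∀-Subset? λ t →
  exceptional? t →-dec ∀-Subset? λ h → obstructed? (oneProbe t h)} _

pairType-obstructed : ∀ i h → lookup h zero ≡ true ⊎ Obstructed (oneProbe (pairType i) h)
pairType-obstructed = toWitness {a? = all? λ i → ∀-Subset? λ h →
  (lookup h zero ≟ᵇ true) ⊎-dec obstructed? (oneProbe (pairType i) h)} _

forkType-obstructed : ∀ i → Obstructed (oneProbe (forkType i) ⊥)
forkType-obstructed = toWitness {a? = all? λ i → obstructed? (oneProbe (forkType i) ⊥)} _

colourClass-obstructed : ∀ k →
  All (λ t → All (λ u → ∀ g h → Obstructed (twoProbes t u g h true)) (colourClass k)) (colourClass k)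
colourClass-obstructed = toWitness {a? = all? λ k →
  All.all? (λ t → All.all? (λ u → ∀-Subset? λ g → ∀-Subset? λ h →
    obstructed? (twoProbes t u g h true)) (colourClass k)) (colourClass k)} _

module Attachment {G : Graph} (C : Hole5 G) where

  open ≡-Reasoning

  attachment : V G → Subset 5
  attachment z = tabulate (λ j → Graph.adj G z (emb C j))

  lookup-attachment : ∀ z j → lookup (attachment z) j ≡ Graph.adj G z (emb C j)
  lookup-attachment z = lookup∘tabulate (λ j → Graph.adj G z (emb C j))

  attachment-lookup : ∀ {z t} → attachment z ≡ t → ∀ j → Graph.adj G z (emb C j) ≡ lookup t j
  attachment-lookup {z} refl j = sym (lookup-attachment z j)

  NT-attachment : ∀ {T z} → NT G C T z → attachment z ≡ indicator T
  NT-attachment {T} {z} (_ , sees) = tabulate-cong sees-iff-member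
    where
    sees-iff-member : ∀ j → Graph.adj G z (emb C j) ≡ does (j ∈? T)
    sees-iff-member j with j ∈? T
    ... | yes j∈T = Equivalence.from (sees j) j∈T
    ... | no j∉T = ¬-not (j∉T ∘ Equivalence.to (sees j))

  ∈-all5 : ∀ j → j ∈ all5 G C
  ∈-all5 zero = here refl
  ∈-all5 (suc zero) = there (here refl)
  ∈-all5 (suc (suc zero)) = there (there (here refl))
  ∈-all5 (suc (suc (suc zero))) = there (there (there (here refl)))
  ∈-all5 (suc (suc (suc (suc zero)))) = there (there (there (there (here refl))))

  Nall-complete : ∀ {z} → Nall G C z → ∀ j → E G z (emb C j)
  Nall-complete (_ , sees) j = Equivalence.from (sees j) (∈-all5 j)

  C5-successor : ∀ j → Graph.adj C5 j (j ⊕ 1) ≡ true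
  C5-successor = toWitness {a? = all? λ j → Graph.adj C5 j (j ⊕ 1) ≟ᵇ true} _

  attachment-nontrivial : ∀ {z} → ¬ Nall G C z → ¬ MC G C z →
    attachment z ≢ ⊥ × attachment z ≢ ⊤
  attachment-nontrivial {z} z∉N z∉M with any? (λ j → z ≟ emb C j)
  ... | yes (j , refl) = hole-sees-successor , hole-misses-itself
    where
    hole-sees-successor : attachment (emb C j) ≢ ⊥
    hole-sees-successor isolated = true≢false (begin
      true                                    ≡⟨ sym (C5-successor j) ⟩
      Graph.adj C5 j (j ⊕ 1)                  ≡⟨ emb-adj C j (j ⊕ 1) ⟩
      Graph.adj G (emb C j) (emb C (j ⊕ 1))  ≡⟨ attachment-lookup isolated (j ⊕ 1) ⟩
      lookup ⊥ (j ⊕ 1)                        ≡⟨ lookup-replicate (j ⊕ 1) false ⟩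
      false                                   ∎)
    hole-misses-itself : attachment (emb C j) ≢ ⊤
    hole-misses-itself universal = true≢false (begin
      true                           ≡⟨ sym (lookup-replicate j true) ⟩
      lookup ⊤ j                     ≡⟨ sym (attachment-lookup universal j) ⟩
      Graph.adj G (emb C j) (emb C j) ≡⟨ Graph.adj-irr G (emb C j) ⟩
      false                          ∎)
  ... | no z∉C = isolated-in-M , universal-in-N
    where
    isolated-in-M : attachment z ≢ ⊥
    isolated-in-M isolated = z∉M (z∉C , λ (_ , j , z~vⱼ) → true≢false (begin
      true                      ≡⟨ sym z~vⱼ ⟩
      Graph.adj G z (emb C j)   ≡⟨ attachment-lookup isolated j ⟩
      lookup ⊥ j                ≡⟨ lookup-replicate j false ⟩
      false                     ∎))
    universal-in-N : attachment z ≢ ⊤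
    universal-in-N universal = z∉N (z∉C , λ j → mk⇔ (λ _ → ∈-all5 j)
      (λ _ → trans (attachment-lookup universal j) (lookup-replicate j true)))

module Configuration {G : Graph} (P5-free : Free P5 G) (K1+K1∪K3-free : Free K1+K1∪K3 G)
  (C : Hole5 G) {u w : V G} (u∈N : Nall G C u) (w∈N : Nall G C w) (u~w : E G u w) where

  open Attachment C

  private
    adj = Graph.adj G
    adj-sym = Graph.adj-sym G
    adj-irr = Graph.adj-irr G

  hubNeighbourhood : V G → Subset 2
  hubNeighbourhood z = adj z u ∷ adj z w ∷ []

  configuration : V G → V G → Config
  configuration p q = twoProbes (attachment p) (attachment q)
    (hubNeighbourhood p) (hubNeighbourhood q) (adj p q)

  place : V G → V G → Point → V G
  place p q (hole i) = emb C i
  place p q x₁ = u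
  place p q x₂ = w
  place p q z₁ = p
  place p q z₂ = q

  realises : ∀ p q a b → adjᶜ (configuration p q) a b ≡ adj (place p q a) (place p q b)
  realises p q (hole i) (hole j) = emb-adj C i j
  realises p q (hole i) x₁ = sym (E-sym {G} (Nall-complete u∈N i))
  realises p q (hole i) x₂ = sym (E-sym {G} (Nall-complete w∈N i))
  realises p q x₁ (hole i) = sym (Nall-complete u∈N i)
  realises p q x₂ (hole i) = sym (Nall-complete w∈N i)
  realises p q x₁ x₁ = sym (adj-irr u)
  realises p q x₁ x₂ = sym u~w
  realises p q x₂ x₁ = sym (E-sym {G} u~w)
  realises p q x₂ x₂ = sym (adj-irr w)
  realises p q (hole i) z₁ = trans (lookup-attachment p i) (adj-sym p (emb C i))
  realises p q (hole i) z₂ = trans (lookup-attachment q i) (adj-sym q (emb C i))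
  realises p q z₁ (hole i) = lookup-attachment p i
  realises p q z₂ (hole i) = lookup-attachment q i
  realises p q x₁ z₁ = adj-sym p u
  realises p q x₂ z₁ = adj-sym p w
  realises p q x₁ z₂ = adj-sym q u
  realises p q x₂ z₂ = adj-sym q w
  realises p q z₁ x₁ = refl
  realises p q z₁ x₂ = refl
  realises p q z₂ x₁ = refl
  realises p q z₂ x₂ = refl
  realises p q z₁ z₁ = sym (adj-irr p)
  realises p q z₁ z₂ = refl
  realises p q z₂ z₁ = adj-sym p q
  realises p q z₂ z₂ = sym (adj-irr q)

  realised-induced : ∀ {H p q fs} → TwinFree H → Any (Induces H (configuration p q)) fs → Induced H G
  realised-induced {p = p} {q} twinFree found =
    twinFree-induced twinFree (place p q ∘ lookup f)
      (λ a b → trans (f-induces a b) (realises p q (lookup f a) (lookup f b)))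
    where
    f = proj₁ (Any.satisfied found)
    f-induces = proj₂ (Any.satisfied found)

  unobstructed : ∀ p q → ¬ Obstructed (configuration p q)
  unobstructed p q (inj₁ path) = P5-free (realised-induced P5-twinFree path)
  unobstructed p q (inj₂ pendantK₄) = K1+K1∪K3-free (realised-induced K1+K1∪K3-twinFree pendantK₄)

  unobstructed-alone : ∀ p → ¬ Obstructed (oneProbe (attachment p) (hubNeighbourhood p))
  unobstructed-alone p = subst (¬_ ∘ Obstructed ∘ twoProbes _ _ _ _) (adj-irr p) (unobstructed p p)

  no-exceptional-attachment : ∀ p → ¬ Exceptional (attachment p)
  no-exceptional-attachment p exceptional =
    unobstructed-alone p (exceptional-obstructed (attachment p) exceptional (hubNeighbourhood p))

  pairType-sees-hub : ∀ {p} i → attachment p ≡ pairType i → E G p u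
  pairType-sees-hub {p} i p∈Nᵢ = [ id , (λ obstructed → ⊥-elim (unobstructed-alone p
    (subst (λ t → Obstructed (oneProbe t (hubNeighbourhood p))) (sym p∈Nᵢ) obstructed))) ]′
    (pairType-obstructed i (hubNeighbourhood p))

  forkType-dominates-hubs : ∀ {p} i → attachment p ≡ forkType i → E G p u ⊎ E G p w
  forkType-dominates-hubs {p} i p∈Nᵢ with adj p u in p-u | adj p w in p-w
  ... | true  | _     = inj₁ refl
  ... | false | true  = inj₂ refl
  ... | false | false = ⊥-elim (unobstructed-alone p (subst₂ (λ t h → Obstructed (oneProbe t h))
        (sym p∈Nᵢ) (sym (cong₂ (λ a b → a ∷ b ∷ []) p-u p-w)) (forkType-obstructed i)))

  colourClass-independent : ∀ {k p q} →
    attachment p ∈ colourClass k → attachment q ∈ colourClass k → ¬ E G p q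
  colourClass-independent {k} {p} {q} p∈k q∈k p~q =
    unobstructed p q (subst (Obstructed ∘ adjacentProbes) (sym p~q) obstructed)
    where
    adjacentProbes : Bool → Config
    adjacentProbes = twoProbes (attachment p) (attachment q) (hubNeighbourhood p) (hubNeighbourhood q)
    obstructed : Obstructed (adjacentProbes true)
    obstructed = All.lookup (All.lookup (colourClass-obstructed k) p∈k) q∈k
      (hubNeighbourhood p) (hubNeighbourhood q)

  domain-admissible : ∀ {z} → ¬ Nall G C z → ¬ MC G C z → Admissible (attachment z)
  domain-admissible {z} z∉N z∉M with attachment-nontrivial z∉N z∉M
  ... | z≢⊥ , z≢⊤ = decidable-stable (admissible? (attachment z)) λ inadmissible →
    no-exceptional-attachment z (z≢⊥ , z≢⊤ , inadmissible)

  colouring : V G → Fin 5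
  colouring z = colourOf (admissible? (attachment z))

  colouring-class : ∀ {z} → ¬ Nall G C z → ¬ MC G C z → attachment z ∈ colourClass (colouring z)
  colouring-class {z} z∉N z∉M =
    colourOf-class (admissible? (attachment z)) (domain-admissible z∉N z∉M)

  colouring-proper : ChiAtMost G (λ z → ¬ Nall G C z × ¬ MC G C z) 5
  colouring-proper = colouring , λ p q (p∉N , p∉M) (q∉N , q∉M) p~q same-colour →
    colourClass-independent {colouring p} (colouring-class p∉N p∉M)
      (subst (λ k → attachment q ∈ colourClass k) (sym same-colour) (colouring-class q∉N q∉M)) p~q

module Component {G : Graph} (P5-free : Free P5 G) (K1+K1∪K3-free : Free K1+K1∪K3 G)
  (C : Hole5 G) {s : V G} (ω≥2 : ClNumAtLeast G (CompOf G C s) 2) where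

  open Attachment C

  module Hubs {u w} (u∈N : Nall G C u) (w∈N : Nall G C w) (u~w : E G u w) =
    Configuration P5-free K1+K1∪K3-free C u∈N w∈N u~w

  private
    S : V G → Set
    S = CompOf G C s

    x₀ y₀ : V G
    x₀ = proj₁ ω≥2 zero
    y₀ = proj₁ ω≥2 (suc zero)

    x₀≢y₀ : x₀ ≢ y₀
    x₀≢y₀ eq with proj₁ (proj₂ ω≥2) eq
    ... | ()

    x₀∈S : S x₀
    x₀∈S = proj₁ (proj₂ (proj₂ ω≥2)) zero

    y₀∈S : S y₀
    y₀∈S = proj₁ (proj₂ (proj₂ ω≥2)) (suc zero)

  open Hubs (proj₁ x₀∈S) (proj₁ y₀∈S) (proj₂ (proj₂ (proj₂ ω≥2)) zero (suc zero) λ ())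
    public using (no-exceptional-attachment; colourClass-independent; colouring-proper)

  S-neighbour : ∀ {y} → S y → ∃ λ y' → Nall G C y' × E G y y'
  S-neighbour (_ , s⇝y) = component-neighbour (proj₂ x₀∈S) (proj₂ y₀∈S) x₀≢y₀ s⇝y

  N-pair-complete-to-S : ∀ i x y →
    (NT G C (i ∷ (i ⊕ 2) ∷ []) x ⊎ NT G C (i ∷ (i ⊕ 1) ∷ (i ⊕ 2) ∷ []) x) →
    S y → E G x y
  N-pair-complete-to-S i x y (inj₁ x∈N) y∈S with S-neighbour y∈S
  ... | y' , y'∈N , y~y' = Hubs.pairType-sees-hub (proj₁ y∈S) y'∈N y~y' i (NT-attachment x∈N)
  N-pair-complete-to-S i x y (inj₂ x∈N) y∈S = ⊥-elim (no-exceptional-attachment x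
    (subst Exceptional (sym (NT-attachment x∈N)) (proj₁ (runs-exceptional i))))

  N-pair-independent : ∀ i x y →
    NT G C (i ∷ (i ⊕ 2) ∷ []) x → NT G C (i ∷ (i ⊕ 2) ∷ []) y → ¬ E G x y
  N-pair-independent i x y x∈N y∈N = colourClass-independent {i ⊕ 3}
    (subst (_∈ colourClass (i ⊕ 3)) (sym (NT-attachment x∈N)) (pairType-colourClass i))
    (subst (_∈ colourClass (i ⊕ 3)) (sym (NT-attachment y∈N)) (pairType-colourClass i))

  S-edge-dominated : ∀ i x y → S x → S y → E G x y →
    ∀ z → (NT G C (i ∷ (i ⊕ 1) ∷ (i ⊕ 3) ∷ []) z
           ⊎ NT G C (i ∷ (i ⊕ 1) ∷ (i ⊕ 2) ∷ (i ⊕ 3) ∷ []) z) →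
    E G z x ⊎ E G z y
  S-edge-dominated i x y x∈S y∈S x~y z (inj₁ z∈N) =
    Hubs.forkType-dominates-hubs (proj₁ x∈S) (proj₁ y∈S) x~y i (NT-attachment z∈N)
  S-edge-dominated i x y x∈S y∈S x~y z (inj₂ z∈N) = ⊥-elim (no-exceptional-attachment z
    (subst Exceptional (sym (NT-attachment z∈N)) (proj₁ (proj₂ (runs-exceptional i)))))

  N-pair-anticomplete : ∀ i x z → NT G C (i ∷ (i ⊕ 2) ∷ []) x →
    (NT G C ((i ⊕ 4) ∷ i ∷ (i ⊕ 1) ∷ []) z
     ⊎ NT G C ((i ⊕ 4) ∷ i ∷ (i ⊕ 2) ∷ []) z
     ⊎ NT G C ((i ⊕ 4) ∷ i ∷ (i ⊕ 1) ∷ (i ⊕ 2) ∷ []) z) → ¬ E G x z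
  N-pair-anticomplete i x z x∈N (inj₁ z∈N) _ = no-exceptional-attachment z
    (subst Exceptional (sym (NT-attachment z∈N)) (proj₁ (proj₂ (proj₂ (runs-exceptional i)))))
  N-pair-anticomplete i x z x∈N (inj₂ (inj₁ z∈N)) = colourClass-independent {i ⊕ 3}
    (subst (_∈ colourClass (i ⊕ 3)) (sym (NT-attachment x∈N)) (pairType-colourClass i))
    (subst (_∈ colourClass (i ⊕ 3)) (sym (NT-attachment z∈N)) (fork-colourClass i))
  N-pair-anticomplete i x z x∈N (inj₂ (inj₂ z∈N)) _ = no-exceptional-attachment z
    (subst Exceptional (sym (NT-attachment z∈N)) (proj₂ (proj₂ (proj₂ (runs-exceptional i)))))

lemma3p2 : (G : Graph) → Connected G → Free P5 G → Free K1+K1∪K3 G →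
    HasNoCliqueCutset G → (C : Hole5 G) →
    (s : V G) → Nall G C s → ClNumAtLeast G (CompOf G C s) 2 →
    ((i : Fin 5) →
      ((∀ x y → (NT G C (i ∷ (i ⊕ 2) ∷ []) x ⊎ NT G C (i ∷ (i ⊕ 1) ∷ (i ⊕ 2) ∷ []) x) →
          CompOf G C s y → E G x y)
       × (∀ x y → NT G C (i ∷ (i ⊕ 2) ∷ []) x → NT G C (i ∷ (i ⊕ 2) ∷ []) y → ¬ E G x y))
      × (∀ x y → CompOf G C s x → CompOf G C s y → E G x y →
          ∀ z → (NT G C (i ∷ (i ⊕ 1) ∷ (i ⊕ 3) ∷ []) z
                 ⊎ NT G C (i ∷ (i ⊕ 1) ∷ (i ⊕ 2) ∷ (i ⊕ 3) ∷ []) z) →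
          E G z x ⊎ E G z y)
      × (∀ x z → NT G C (i ∷ (i ⊕ 2) ∷ []) x →
          (NT G C ((i ⊕ 4) ∷ i ∷ (i ⊕ 1) ∷ []) z
           ⊎ NT G C ((i ⊕ 4) ∷ i ∷ (i ⊕ 2) ∷ []) z
           ⊎ NT G C ((i ⊕ 4) ∷ i ∷ (i ⊕ 1) ∷ (i ⊕ 2) ∷ []) z) →
          ¬ E G x z))
    × ChiAtMost G (λ x → ¬ Nall G C x × ¬ MC G C x) 5
lemma3p2 G _ P5-free K1+K1∪K3-free _ C s _ ω≥2 =
  (λ i → (N-pair-complete-to-S i , N-pair-independent i) , S-edge-dominated i , N-pair-anticomplete i)
  , colouring-proper
  where open Component P5-free K1+K1∪K3-free C ω≥2
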